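{- Let $\alpha\in\{2,3,\dots,\omega\}$ and let $(C,\odot_i,s_i,t_i)_{0\le i<\alpha}$ be a family of catoids on the same set $C$ satisfying, for all $0\le i<j<\alpha$ and all $w,x,y,z\in C$, $s_j(x\odot_i y)\subseteq s_j(x)\odot_i s_j(y)$, $t_j(x\odot_i y)\subseteq t_j(x)\odot_i t_j(y)$ and $(w\odot_j x)\odot_i(y\odot_j z)\subseteq(w\odot_i y)\odot_j(x\odot_i z)$. Then it is an $\alpha$-catoid. Moreover, these three families of axioms are irredundant: none of them follows from the other two together with the catoid axioms.
   Context: A catoid $(C,\odot,s,t)$ is a set with $\odot:C\times C\to\mathcal P C$ and $s,t:C\to C$ such that, with $X\odot Y=\bigcup_{x\in X,y\in Y}x\odot y$: $x\odot(y\odot z)=(x\odot y)\odot z$, $x\odot y\ne\emptyset\Rightarrow t(x)=s(y)$, $s(x)\odot x=\{x\}$, $x\odot t(x)=\{x\}$. Direct images under $s,t$ are written $s(X),t(X)$. An $\alpha$-catoid is a family $(C,\odot_i,s_i,t_i)_{0\le i<\alpha}$ of catoids on one set such that for all $i\neq j$: $s_i\circ s_j=s_j\circ s_i$, $s_i\circ t_j=t_j\circ s_i$, $t_i\circ t_j=t_j\circ t_i$, $s_i(x\odot_j y)\subseteq s_i(x)\odot_j s_i(y)$, $t_i(x\odot_j y)\subseteq t_i(x)\odot_j t_i(y)$; and for all $i<j$: $(w\odot_j x)\odot_i(y\odot_j z)\subseteq(w\odot_i y)\odot_j(x\odot_i z)$, $s_j\circ s_i=s_i$, $s_j\circ t_i=t_i$,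 $t_j\circ s_i=s_i$, $t_j\circ t_i=t_i$. -}

module Defs where

open import Data.Nat using (ℕ; _<_; _≤_)
open import Data.Fin using (Fin; toℕ)
open import Data.Product using (Σ; ∃; _×_; _,_)
open import Relation.Binary.PropositionalEquality using (_≡_; _≢_)
open import Relation.Nullary using (¬_)

data ℕω : Set where
  fin : ℕ → ℕω
  ω   : ℕω

data TwoLe : ℕω → Set where
  fin≥2 : ∀ {n} → 2 ≤ n → TwoLe (fin n)
  ω≥2   : TwoLe ω

Idx : ℕω → Set
Idx (fin n) = Fin n
Idx ω       = ℕ

ix : ∀ {α} → Idx α → ℕ
ix {fin n} i = toℕ i
ix {ω}     i = i

_<ᵢ_ : ∀ {α} → Idx α → Idx α → Set
i <ᵢ j = ix i < ix j

Pow : Set → Set₁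
Pow C = C → Set

⟦_⟧ : ∀ {C : Set} → C → Pow C
⟦ x ⟧ z = z ≡ x

_⊆_ : ∀ {C : Set} → Pow C → Pow C → Set
X ⊆ Y = ∀ z → X z → Y z

_≐_ : ∀ {C : Set} → Pow C → Pow C → Set
X ≐ Y = (X ⊆ Y) × (Y ⊆ X)

img : ∀ {C : Set} → (C → C) → Pow C → Pow C
img f X z = ∃ λ x → X x × f x ≡ z

MOp : Set → Set₁
MOp C = C → C → Pow C

lift : ∀ {C : Set} → MOp C → Pow C → Pow C → Pow C
lift _⊙_ X Y z = ∃ λ x → ∃ λ y → X x × Y y × (x ⊙ y) z

record IsCatoid (C : Set) (_⊙_ : MOp C) (s t : C → C) : Set where
  field
    assoc : ∀ x y z →
      lift _⊙_ ⟦ x ⟧ (y ⊙ z) ≐ lift _⊙_ (x ⊙ y) ⟦ z ⟧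
    local : ∀ x y → (∃ λ z → (x ⊙ y) z) → t x ≡ s y
    sl    : ∀ x → (s x ⊙ x) ≐ ⟦ x ⟧
    tr    : ∀ x → (x ⊙ t x) ≐ ⟦ x ⟧

record Family (α : ℕω) (C : Set) : Set₁ where
  field
    mul : Idx α → MOp C
    src : Idx α → C → C
    tgt : Idx α → C → C

module _ {α : ℕω} {C : Set} (F : Family α C) where
  open Family F

  AllCatoids : Set
  AllCatoids = ∀ i → IsCatoid C (mul i) (src i) (tgt i)

  AxSrcHom : Set
  AxSrcHom = ∀ (i j : Idx α) → i <ᵢ j → ∀ x y →
    img (src j) (mul i x y) ⊆ mul i (src j x) (src j y)

  AxTgtHom : Set
  AxTgtHom = ∀ (i j : Idx α) → i <ᵢ j → ∀ x y →
    img (tgt j) (mul i x y) ⊆ mul i (tgt j x) (tgt j y)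

  AxInterchange : Set
  AxInterchange = ∀ (i j : Idx α) → i <ᵢ j → ∀ w x y z →
    lift (mul i) (mul j w x) (mul j y z) ⊆ lift (mul j) (mul i w y) (mul i x z)

  record IsAlphaCatoid : Set where
    field
      catoids : AllCatoids
      ss-comm : ∀ i j → i ≢ j → ∀ x → src i (src j x) ≡ src j (src i x)
      st-comm : ∀ i j → i ≢ j → ∀ x → src i (tgt j x) ≡ tgt j (src i x)
      tt-comm : ∀ i j → i ≢ j → ∀ x → tgt i (tgt j x) ≡ tgt j (tgt i x)
      s-hom   : ∀ i j → i ≢ j → ∀ x y →
        img (src i) (mul j x y) ⊆ mul j (src i x) (src i y)
      t-hom   : ∀ i j → i ≢ j → ∀ x y →
        img (tgt i) (mul j x y) ⊆ mul j (tgt i x) (tgt i y)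
      interchange : ∀ i j → i <ᵢ j → ∀ w x y z →
        lift (mul i) (mul j w x) (mul j y z) ⊆ lift (mul j) (mul i w y) (mul i x z)
      ss-abs : ∀ i j → i <ᵢ j → ∀ x → src j (src i x) ≡ src i x
      st-abs : ∀ i j → i <ᵢ j → ∀ x → src j (tgt i x) ≡ tgt i x
      ts-abs : ∀ i j → i <ᵢ j → ∀ x → tgt j (src i x) ≡ src i x
      tt-abs : ∀ i j → i <ᵢ j → ∀ x → tgt j (tgt i x) ≡ tgt i x

Irredundant : ℕω → Set₁
Irredundant α =
    (∃ λ (C : Set) → ∃ λ (F : Family α C) →
       AllCatoids F × ¬ AxSrcHom F × AxTgtHom F × AxInterchange F)
  × (∃ λ (C : Set) → ∃ λ (F : Family α C) →
       AllCatoids F × AxSrcHom F × ¬ AxTgtHom F × AxInterchange F)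
  × (∃ λ (C : Set) → ∃ λ (F : Family α C) →
       AllCatoids F × AxSrcHom F × AxTgtHom F × ¬ AxInterchange F)

module Submission where

-- If a is an i-identity (i < j), interchange applied to
-- a ∈ (sⱼ a ⊙ⱼ a) ⊙ᵢ (a ⊙ⱼ tⱼ a) shows that a is also a j-identity; this gives
-- the absorption laws. Feeding x ∈ sᵢ x ⊙ᵢ x through the homomorphism axioms for
-- sⱼ, tⱼ then yields sᵢ ∘ sⱼ = sᵢ and its variants, hence the commutation laws and
-- the homomorphism laws for the lower structure maps. For irredundance, each axiom
-- fails in a two-layer family on three elements satisfying the other two, padded
-- with discrete catoids at the indices ≥ 2.

open import Defs
open import Data.Nat using (ℕ; suc; _<_; s≤s; z≤n)
open import Data.Nat.Properties using (<-cmp)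
open import Data.Fin as Fin using (Fin)
open import Data.Fin.Properties using (toℕ-injective; any?; all?; _≟_)
open import Data.List using (List; []; _∷_)
open import Data.Product using (∃; _×_; _,_; proj₁; proj₂)
open import Data.Empty using (⊥-elim)
open import Function using (_∘_; id; flip; const)
open import Relation.Binary using (tri<; tri≈; tri>)
open import Relation.Binary.PropositionalEquality
  using (_≡_; _≢_; _≗_; refl; sym; trans; cong; subst; subst₂; module ≡-Reasoning)
open import Relation.Nullary using (¬_; Dec)
open import Relation.Nullary.Decidable
  using (True; False; toWitness; toWitnessFalse; map′; _×-dec_; _→-dec_)
open import Relation.Unary using (Decidable)

module CatoidProperties {C : Set} {_⊙_ : MOp C} {s t : C → C}
                        (K : IsCatoid C _⊙_ s t) where
  open IsCatoid K

  x∈sx⊙x : ∀ x → (s x ⊙ x) x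
  x∈sx⊙x x = proj₂ (sl x) x refl

  x∈x⊙tx : ∀ x → (x ⊙ t x) x
  x∈x⊙tx x = proj₂ (tr x) x refl

  t∘s≗s : t ∘ s ≗ s
  t∘s≗s x = local (s x) x (x , x∈sx⊙x x)

  s∘t≗t : s ∘ t ≗ t
  s∘t≗t x = sym (local x (t x) (x , x∈x⊙tx x))

  s-⊙ : ∀ {x y z} → (x ⊙ y) z → s z ≡ s x
  s-⊙ {x} {y} {z} z∈x⊙y
    with proj₁ (assoc (s z) x y) z (s z , z , refl , z∈x⊙y , x∈sx⊙x z)
  ... | u , _ , u∈sz⊙x , _ = trans (sym (t∘s≗s z)) (local (s z) x (u , u∈sz⊙x))

  t-⊙ : ∀ {x y z} → (x ⊙ y) z → t z ≡ t y
  t-⊙ {x} {y} {z} z∈x⊙y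
    with proj₂ (assoc x y (t z)) z (z , t z , z∈x⊙y , refl , x∈x⊙tx z)
  ... | _ , v , _ , v∈y⊙tz , _ = sym (trans (local y (t z) (v , v∈y⊙tz)) (s∘t≗t z))

  s∘s≗s : s ∘ s ≗ s
  s∘s≗s x = sym (s-⊙ (x∈sx⊙x x))

  t∘t≗t : t ∘ t ≗ t
  t∘t≗t x = sym (t-⊙ (x∈x⊙tx x))

module LowerUpper {C : Set} {_⊙ᵢ_ _⊙ⱼ_ : MOp C} {sᵢ tᵢ sⱼ tⱼ : C → C}
  (Kᵢ : IsCatoid C _⊙ᵢ_ sᵢ tᵢ) (Kⱼ : IsCatoid C _⊙ⱼ_ sⱼ tⱼ)
  (interchange : ∀ w x y z →
    lift _⊙ᵢ_ (w ⊙ⱼ x) (y ⊙ⱼ z) ⊆ lift _⊙ⱼ_ (w ⊙ᵢ y) (x ⊙ᵢ z)) where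
  module I = IsCatoid Kᵢ
  module J = IsCatoid Kⱼ
  module Iₚ = CatoidProperties Kᵢ
  module Jₚ = CatoidProperties Kⱼ

  -- With a = sᵢ a, interchange puts a ∈ (sⱼ a ⊙ⱼ a) ⊙ᵢ (a ⊙ⱼ tⱼ a) into
  -- (sⱼ a ⊙ᵢ a) ⊙ⱼ (a ⊙ᵢ tⱼ a) = sⱼ a ⊙ⱼ tⱼ a, and locality of ⊙ⱼ then forces
  -- sⱼ a = tⱼ a = a.
  identityᵢ⇒identityⱼ : ∀ {a} → sᵢ a ≡ a → sⱼ a ≡ a × tⱼ a ≡ a
  identityᵢ⇒identityⱼ {a} sᵢa≡a
    with interchange (sⱼ a) a a (tⱼ a) a
           (a , a , Jₚ.x∈sx⊙x a , Jₚ.x∈x⊙tx a , subst (λ b → (b ⊙ᵢ a) a) sᵢa≡a (Iₚ.x∈sx⊙x a))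
  ... | u , v , u∈sⱼa⊙ᵢa , v∈a⊙ᵢtⱼa , a∈u⊙ⱼv = sⱼa≡a , trans (sym sⱼa≡tⱼa) sⱼa≡a
    where
      tᵢa≡a : tᵢ a ≡ a
      tᵢa≡a = trans (cong tᵢ (sym sᵢa≡a)) (trans (Iₚ.t∘s≗s a) sᵢa≡a)
      u≡sⱼa : u ≡ sⱼ a
      u≡sⱼa = proj₁ (I.tr (sⱼ a)) u
        (subst (λ b → (sⱼ a ⊙ᵢ b) u) (sym (trans (I.local (sⱼ a) a (u , u∈sⱼa⊙ᵢa)) sᵢa≡a)) u∈sⱼa⊙ᵢa)
      v≡tⱼa : v ≡ tⱼ a
      v≡tⱼa = proj₁ (I.sl (tⱼ a)) v
        (subst (λ b → (b ⊙ᵢ tⱼ a) v) (trans (sym tᵢa≡a) (I.local a (tⱼ a) (v , v∈a⊙ᵢtⱼa))) v∈a⊙ᵢtⱼa)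
      a∈sⱼa⊙ⱼtⱼa : (sⱼ a ⊙ⱼ tⱼ a) a
      a∈sⱼa⊙ⱼtⱼa = subst₂ (λ b c → (b ⊙ⱼ c) a) u≡sⱼa v≡tⱼa a∈u⊙ⱼv
      sⱼa≡tⱼa : sⱼ a ≡ tⱼ a
      sⱼa≡tⱼa = trans (sym (Jₚ.t∘s≗s a)) (trans (J.local (sⱼ a) (tⱼ a) (a , a∈sⱼa⊙ⱼtⱼa)) (Jₚ.s∘t≗t a))
      sⱼa≡a : sⱼ a ≡ a
      sⱼa≡a = sym (proj₁ (J.tr (sⱼ a)) a
        (subst (λ b → (sⱼ a ⊙ⱼ b) a) (trans (sym sⱼa≡tⱼa) (sym (Jₚ.t∘s≗s a))) a∈sⱼa⊙ⱼtⱼa))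

  sⱼ∘sᵢ≗sᵢ : sⱼ ∘ sᵢ ≗ sᵢ
  sⱼ∘sᵢ≗sᵢ x = proj₁ (identityᵢ⇒identityⱼ (Iₚ.s∘s≗s x))

  tⱼ∘sᵢ≗sᵢ : tⱼ ∘ sᵢ ≗ sᵢ
  tⱼ∘sᵢ≗sᵢ x = proj₂ (identityᵢ⇒identityⱼ (Iₚ.s∘s≗s x))

  sⱼ∘tᵢ≗tᵢ : sⱼ ∘ tᵢ ≗ tᵢ
  sⱼ∘tᵢ≗tᵢ x = proj₁ (identityᵢ⇒identityⱼ (Iₚ.s∘t≗t x))

  tⱼ∘tᵢ≗tᵢ : tⱼ ∘ tᵢ ≗ tᵢ
  tⱼ∘tᵢ≗tᵢ x = proj₂ (identityᵢ⇒identityⱼ (Iₚ.s∘t≗t x))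

  sᵢx∈sᵢx⊙ⱼsᵢx : ∀ x → (sᵢ x ⊙ⱼ sᵢ x) (sᵢ x)
  sᵢx∈sᵢx⊙ⱼsᵢx x = subst (λ b → (sᵢ x ⊙ⱼ b) (sᵢ x)) (tⱼ∘sᵢ≗sᵢ x) (Jₚ.x∈x⊙tx (sᵢ x))

  tᵢx∈tᵢx⊙ⱼtᵢx : ∀ x → (tᵢ x ⊙ⱼ tᵢ x) (tᵢ x)
  tᵢx∈tᵢx⊙ⱼtᵢx x = subst (λ b → (tᵢ x ⊙ⱼ b) (tᵢ x)) (tⱼ∘tᵢ≗tᵢ x) (Jₚ.x∈x⊙tx (tᵢ x))

  module Homomorphic (sⱼ-hom : ∀ x y → img sⱼ (x ⊙ᵢ y) ⊆ (sⱼ x ⊙ᵢ sⱼ y))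
           (tⱼ-hom : ∀ x y → img tⱼ (x ⊙ᵢ y) ⊆ (tⱼ x ⊙ᵢ tⱼ y)) where

    sᵢ∘sⱼ≗sᵢ : sᵢ ∘ sⱼ ≗ sᵢ
    sᵢ∘sⱼ≗sᵢ x = begin
      sᵢ (sⱼ x)        ≡⟨ Iₚ.s-⊙ (sⱼ-hom (sᵢ x) x (sⱼ x) (x , Iₚ.x∈sx⊙x x , refl)) ⟩
      sᵢ (sⱼ (sᵢ x))   ≡⟨ cong sᵢ (sⱼ∘sᵢ≗sᵢ x) ⟩
      sᵢ (sᵢ x)        ≡⟨ Iₚ.s∘s≗s x ⟩
      sᵢ x             ∎
      where open ≡-Reasoning

    tᵢ∘sⱼ≗tᵢ : tᵢ ∘ sⱼ ≗ tᵢ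
    tᵢ∘sⱼ≗tᵢ x = begin
      tᵢ (sⱼ x)        ≡⟨ Iₚ.t-⊙ (sⱼ-hom x (tᵢ x) (sⱼ x) (x , Iₚ.x∈x⊙tx x , refl)) ⟩
      tᵢ (sⱼ (tᵢ x))   ≡⟨ cong tᵢ (sⱼ∘tᵢ≗tᵢ x) ⟩
      tᵢ (tᵢ x)        ≡⟨ Iₚ.t∘t≗t x ⟩
      tᵢ x             ∎
      where open ≡-Reasoning

    sᵢ∘tⱼ≗sᵢ : sᵢ ∘ tⱼ ≗ sᵢ
    sᵢ∘tⱼ≗sᵢ x = begin
      sᵢ (tⱼ x)        ≡⟨ Iₚ.s-⊙ (tⱼ-hom (sᵢ x) x (tⱼ x) (x , Iₚ.x∈sx⊙x x , refl)) ⟩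
      sᵢ (tⱼ (sᵢ x))   ≡⟨ cong sᵢ (tⱼ∘sᵢ≗sᵢ x) ⟩
      sᵢ (sᵢ x)        ≡⟨ Iₚ.s∘s≗s x ⟩
      sᵢ x             ∎
      where open ≡-Reasoning

    tᵢ∘tⱼ≗tᵢ : tᵢ ∘ tⱼ ≗ tᵢ
    tᵢ∘tⱼ≗tᵢ x = begin
      tᵢ (tⱼ x)        ≡⟨ Iₚ.t-⊙ (tⱼ-hom x (tᵢ x) (tⱼ x) (x , Iₚ.x∈x⊙tx x , refl)) ⟩
      tᵢ (tⱼ (tᵢ x))   ≡⟨ cong tᵢ (tⱼ∘tᵢ≗tᵢ x) ⟩
      tᵢ (tᵢ x)        ≡⟨ Iₚ.t∘t≗t x ⟩
      tᵢ x             ∎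
      where open ≡-Reasoning

    sᵢ∘sⱼ≗sⱼ∘sᵢ : sᵢ ∘ sⱼ ≗ sⱼ ∘ sᵢ
    sᵢ∘sⱼ≗sⱼ∘sᵢ x = trans (sᵢ∘sⱼ≗sᵢ x) (sym (sⱼ∘sᵢ≗sᵢ x))

    sᵢ∘tⱼ≗tⱼ∘sᵢ : sᵢ ∘ tⱼ ≗ tⱼ ∘ sᵢ
    sᵢ∘tⱼ≗tⱼ∘sᵢ x = trans (sᵢ∘tⱼ≗sᵢ x) (sym (tⱼ∘sᵢ≗sᵢ x))

    sⱼ∘tᵢ≗tᵢ∘sⱼ : sⱼ ∘ tᵢ ≗ tᵢ ∘ sⱼ
    sⱼ∘tᵢ≗tᵢ∘sⱼ x = trans (sⱼ∘tᵢ≗tᵢ x) (sym (tᵢ∘sⱼ≗tᵢ x))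

    tᵢ∘tⱼ≗tⱼ∘tᵢ : tᵢ ∘ tⱼ ≗ tⱼ ∘ tᵢ
    tᵢ∘tⱼ≗tⱼ∘tᵢ x = trans (tᵢ∘tⱼ≗tᵢ x) (sym (tⱼ∘tᵢ≗tᵢ x))

    -- Every z ∈ x ⊙ⱼ y, and y itself, share the i-source of x, which is a j-identity.
    sᵢ-hom : ∀ x y → img sᵢ (x ⊙ⱼ y) ⊆ (sᵢ x ⊙ⱼ sᵢ y)
    sᵢ-hom x y _ (z , z∈x⊙ⱼy , refl) =
      subst₂ (λ b c → (sᵢ x ⊙ⱼ b) c) (sym sᵢy≡sᵢx) (sym sᵢz≡sᵢx) (sᵢx∈sᵢx⊙ⱼsᵢx x)
      where
        sᵢz≡sᵢx : sᵢ z ≡ sᵢ x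
        sᵢz≡sᵢx = trans (sym (sᵢ∘sⱼ≗sᵢ z)) (trans (cong sᵢ (Jₚ.s-⊙ z∈x⊙ⱼy)) (sᵢ∘sⱼ≗sᵢ x))
        sᵢy≡sᵢx : sᵢ y ≡ sᵢ x
        sᵢy≡sᵢx = trans (sym (sᵢ∘sⱼ≗sᵢ y))
          (trans (cong sᵢ (sym (J.local x y (z , z∈x⊙ⱼy)))) (sᵢ∘tⱼ≗sᵢ x))

    tᵢ-hom : ∀ x y → img tᵢ (x ⊙ⱼ y) ⊆ (tᵢ x ⊙ⱼ tᵢ y)
    tᵢ-hom x y _ (z , z∈x⊙ⱼy , refl) =
      subst₂ (λ b c → (b ⊙ⱼ tᵢ y) c) (sym tᵢx≡tᵢy) (sym tᵢz≡tᵢy) (tᵢx∈tᵢx⊙ⱼtᵢx y)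
      where
        tᵢz≡tᵢy : tᵢ z ≡ tᵢ y
        tᵢz≡tᵢy = trans (sym (tᵢ∘tⱼ≗tᵢ z)) (trans (cong tᵢ (Jₚ.t-⊙ z∈x⊙ⱼy)) (tᵢ∘tⱼ≗tᵢ y))
        tᵢx≡tᵢy : tᵢ x ≡ tᵢ y
        tᵢx≡tᵢy = trans (sym (tᵢ∘tⱼ≗tᵢ x))
          (trans (cong tᵢ (J.local x y (z , z∈x⊙ⱼy))) (tᵢ∘sⱼ≗tᵢ y))

ix-injective : ∀ {α} {i j : Idx α} → ix i ≡ ix j → i ≡ j
ix-injective {fin _} = toℕ-injective
ix-injective {ω}     = id

<ᵢ-cases : ∀ {α} {P : Idx α → Idx α → Set} →
  (∀ i j → i <ᵢ j → P i j) → (∀ i j → j <ᵢ i → P i j) →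
  ∀ i j → i ≢ j → P i j
<ᵢ-cases lower upper i j i≢j with <-cmp (ix i) (ix j)
... | tri< i<j _ _ = lower i j i<j
... | tri≈ _ i≡j _ = ⊥-elim (i≢j (ix-injective i≡j))
... | tri> _ _ j<i = upper i j j<i

module _ {α : ℕω} {C : Set} (F : Family α C) (catoids : AllCatoids F)
         (src-hom : AxSrcHom F) (tgt-hom : AxTgtHom F) (interchange : AxInterchange F) where
  open Family F

  module Pair (i j : Idx α) (i<j : i <ᵢ j) where
    open LowerUpper (catoids i) (catoids j) (interchange i j i<j) public
    open Homomorphic (src-hom i j i<j) (tgt-hom i j i<j) public

  isAlphaCatoid : IsAlphaCatoid F
  isAlphaCatoid = record
    { catoids     = catoids
    ; ss-comm     = <ᵢ-cases Pair.sᵢ∘sⱼ≗sⱼ∘sᵢ (λ i j j<i x → sym (Pair.sᵢ∘sⱼ≗sⱼ∘sᵢ j i j<i x))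
    ; st-comm     = <ᵢ-cases Pair.sᵢ∘tⱼ≗tⱼ∘sᵢ (λ i j j<i → Pair.sⱼ∘tᵢ≗tᵢ∘sⱼ j i j<i)
    ; tt-comm     = <ᵢ-cases Pair.tᵢ∘tⱼ≗tⱼ∘tᵢ (λ i j j<i x → sym (Pair.tᵢ∘tⱼ≗tⱼ∘tᵢ j i j<i x))
    ; s-hom       = <ᵢ-cases Pair.sᵢ-hom (λ i j j<i → src-hom j i j<i)
    ; t-hom       = <ᵢ-cases Pair.tᵢ-hom (λ i j j<i → tgt-hom j i j<i)
    ; interchange = interchange
    ; ss-abs      = Pair.sⱼ∘sᵢ≗sᵢ
    ; st-abs      = Pair.sⱼ∘tᵢ≗tᵢ
    ; ts-abs      = Pair.tⱼ∘sᵢ≗sᵢ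
    ; tt-abs      = Pair.tⱼ∘tᵢ≗tᵢ
    }

record Structure (C : Set) : Set₁ where
  field
    mul     : MOp C
    src tgt : C → C

module _ {C : Set} where
  open Structure

  IsCatoidStructure : Structure C → Set
  IsCatoidStructure A = IsCatoid C (mul A) (src A) (tgt A)

  SrcHom TgtHom Interchange : Structure C → Structure C → Set
  SrcHom A B = ∀ x y → img (src B) (mul A x y) ⊆ mul A (src B x) (src B y)
  TgtHom A B = ∀ x y → img (tgt B) (mul A x y) ⊆ mul A (tgt B x) (tgt B y)
  Interchange A B = ∀ w x y z →
    lift (mul A) (mul B w x) (mul B y z) ⊆ lift (mul B) (mul A w y) (mul A x z)

  discrete : Structure C
  discrete = record { mul = λ x y z → y ≡ x × z ≡ x ; src = id ; tgt = id }

  discrete-isCatoid : IsCatoidStructure discrete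
  discrete-isCatoid = record
    { assoc = λ x y z →
        (λ { _ (_ , _ , refl , (refl , refl) , (refl , refl)) → _ , _ , (refl , refl) , refl , (refl , refl) })
      , (λ { _ (_ , _ , (refl , refl) , refl , (refl , refl)) → _ , _ , refl , (refl , refl) , (refl , refl) })
    ; local = λ { x y (_ , y≡x , _) → sym y≡x }
    ; sl    = λ x → (λ { _ (_ , refl) → refl }) , (λ { _ refl → refl , refl })
    ; tr    = λ x → (λ { _ (_ , refl) → refl }) , (λ { _ refl → refl , refl })
    }

  srcHom-discrete : ∀ A → SrcHom A discrete
  srcHom-discrete A x y _ (_ , z∈x⊙y , refl) = z∈x⊙y

  tgtHom-discrete : ∀ A → TgtHom A discrete
  tgtHom-discrete A x y _ (_ , z∈x⊙y , refl) = z∈x⊙y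

  interchange-discrete : ∀ A → Interchange A discrete
  interchange-discrete A w x y z _ (_ , _ , (refl , refl) , (refl , refl) , p) = _ , _ , p , p , (refl , refl)

  module Stack (A B : Structure C) where
    layer : ℕ → Structure C
    layer 0             = A
    layer 1             = B
    layer (suc (suc _)) = discrete

    stack : (α : ℕω) → Family α C
    stack α = record
      { mul = mul ∘ layer ∘ ix ; src = src ∘ layer ∘ ix ; tgt = tgt ∘ layer ∘ ix }

    stack-catoids : ∀ {α} → IsCatoidStructure A → IsCatoidStructure B → AllCatoids (stack α)
    stack-catoids cA cB i = catoid (ix i)
      where
        catoid : ∀ k → IsCatoidStructure (layer k)
        catoid 0             = cA
        catoid 1             = cB
        catoid (suc (suc _)) = discrete-isCatoid

    module _ (R : Structure C → Structure C → Set) (R-discrete : ∀ A → R A discrete) where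

      stack-pairs : ∀ {α} → R A B → ∀ (i j : Idx α) → i <ᵢ j → R (layer (ix i)) (layer (ix j))
      stack-pairs RAB i j = layers (ix i) (ix j)
        where
          layers : ∀ k l → k < l → R (layer k) (layer l)
          layers 0       1             _         = RAB
          layers k       (suc (suc _)) _         = R-discrete (layer k)
          layers (suc _) 1             (s≤s ())

      stack-pairs⁻¹ : ∀ {α} → TwoLe α →
        (∀ (i j : Idx α) → i <ᵢ j → R (layer (ix i)) (layer (ix j))) → R A B
      stack-pairs⁻¹ (fin≥2 (s≤s (s≤s _))) R-stack = R-stack Fin.zero (Fin.suc Fin.zero) (s≤s z≤n)
      stack-pairs⁻¹ ω≥2                   R-stack = R-stack 0 1 (s≤s z≤n)

record FiniteStructure (n : ℕ) : Set where
  field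
    table   : Fin n → Fin n → List (Fin n)
    src tgt : Fin n → Fin n

module Finite {n : ℕ} where
  open import Data.List.Membership.DecPropositional (_≟_ {n}) using (_∈_; _∈?_)
  open FiniteStructure

  structure : FiniteStructure n → Structure (Fin n)
  structure A = record { mul = λ x y z → z ∈ table A x y ; src = src A ; tgt = tgt A }

  opposite : FiniteStructure n → FiniteStructure n
  opposite A = record { table = flip (table A) ; src = tgt A ; tgt = src A }

  private
    ⟦_⟧? : (x : Fin n) → Decidable ⟦ x ⟧
    ⟦ x ⟧? z = z ≟ x

    mul? : ∀ A (x y : Fin n) → Decidable (Structure.mul (structure A) x y)
    mul? A x y z = z ∈? table A x y

    lift? : ∀ A {X Y : Pow (Fin n)} → Decidable X → Decidable Y → Decidable (lift (Structure.mul (structure A)) X Y)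
    lift? A X? Y? z = any? λ x → any? λ y → X? x ×-dec Y? y ×-dec mul? A x y z

    img? : (f : Fin n → Fin n) {X : Pow (Fin n)} → Decidable X → Decidable (img f X)
    img? f X? z = any? λ x → X? x ×-dec (f x ≟ z)

    ⊆? : ∀ {X Y : Pow (Fin n)} → Decidable X → Decidable Y → Dec (X ⊆ Y)
    ⊆? X? Y? = all? λ z → X? z →-dec Y? z

    ≐? : ∀ {X Y : Pow (Fin n)} → Decidable X → Decidable Y → Dec (X ≐ Y)
    ≐? X? Y? = ⊆? X? Y? ×-dec ⊆? Y? X?

  isCatoid? : ∀ A → Dec (IsCatoidStructure (structure A))
  isCatoid? A = map′
    (λ { (assoc , local , sl , tr) → record { assoc = assoc ; local = local ; sl = sl ; tr = tr } })
    (λ K → IsCatoid.assoc K , IsCatoid.local K , IsCatoid.sl K , IsCatoid.tr K)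
    ( (all? λ x → all? λ y → all? λ z → ≐? (lift? A ⟦ x ⟧? (mul? A y z)) (lift? A (mul? A x y) ⟦ z ⟧?))
    ×-dec (all? λ x → all? λ y → any? (mul? A x y) →-dec (tgt A x ≟ src A y))
    ×-dec (all? λ x → ≐? (mul? A (src A x) x) ⟦ x ⟧?)
    ×-dec (all? λ x → ≐? (mul? A x (tgt A x)) ⟦ x ⟧?))

  srcHom? : ∀ A B → Dec (SrcHom (structure A) (structure B))
  srcHom? A B = all? λ x → all? λ y →
    ⊆? (img? (src B) (mul? A x y)) (mul? A (src B x) (src B y))

  tgtHom? : ∀ A B → Dec (TgtHom (structure A) (structure B))
  tgtHom? A B = all? λ x → all? λ y →
    ⊆? (img? (tgt B) (mul? A x y)) (mul? A (tgt B x) (tgt B y))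

  interchange? : ∀ A B → Dec (Interchange (structure A) (structure B))
  interchange? A B = all? λ w → all? λ x → all? λ y → all? λ z →
    ⊆? (lift? A (mul? B w x) (mul? B y z)) (lift? B (mul? A w y) (mul? A x z))

module Irredundance {α : ℕω} (two : TwoLe α) (A B : FiniteStructure 3)
                    (A-catoid : True (Finite.isCatoid? A)) (B-catoid : True (Finite.isCatoid? B)) where
  open Finite
  open Stack (structure A) (structure B)

  catoids : AllCatoids (stack α)
  catoids = stack-catoids (toWitness A-catoid) (toWitness B-catoid)

  srcHom-independent : False (srcHom? A B) → True (tgtHom? A B) → True (interchange? A B) →
    ∃ λ (C : Set) → ∃ λ (F : Family α C) →
      AllCatoids F × ¬ AxSrcHom F × AxTgtHom F × AxInterchange F
  srcHom-independent ¬src tgt ic =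
    Fin 3 , stack α , catoids
    , toWitnessFalse ¬src ∘ stack-pairs⁻¹ SrcHom srcHom-discrete two
    , stack-pairs TgtHom tgtHom-discrete (toWitness tgt)
    , stack-pairs Interchange interchange-discrete (toWitness ic)

  tgtHom-independent : True (srcHom? A B) → False (tgtHom? A B) → True (interchange? A B) →
    ∃ λ (C : Set) → ∃ λ (F : Family α C) →
      AllCatoids F × AxSrcHom F × ¬ AxTgtHom F × AxInterchange F
  tgtHom-independent src ¬tgt ic =
    Fin 3 , stack α , catoids
    , stack-pairs SrcHom srcHom-discrete (toWitness src)
    , toWitnessFalse ¬tgt ∘ stack-pairs⁻¹ TgtHom tgtHom-discrete two
    , stack-pairs Interchange interchange-discrete (toWitness ic)

  interchange-independent : True (srcHom? A B) → True (tgtHom? A B) → False (interchange? A B) →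
    ∃ λ (C : Set) → ∃ λ (F : Family α C) →
      AllCatoids F × AxSrcHom F × AxTgtHom F × ¬ AxInterchange F
  interchange-independent src tgt ¬ic =
    Fin 3 , stack α , catoids
    , stack-pairs SrcHom srcHom-discrete (toWitness src)
    , stack-pairs TgtHom tgtHom-discrete (toWitness tgt)
    , toWitnessFalse ¬ic ∘ stack-pairs⁻¹ Interchange interchange-discrete two

pattern a₀ = Fin.zero
pattern a₁ = Fin.suc Fin.zero
pattern a₂ = Fin.suc (Fin.suc Fin.zero)

oneObject : (Fin 3 → Fin 3 → List (Fin 3)) → FiniteStructure 3
oneObject f = record { table = table ; src = const a₀ ; tgt = const a₀ }
  where
    table : Fin 3 → Fin 3 → List (Fin 3)
    table a₀ y  = y ∷ []
    table x  a₀ = x ∷ []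
    table x  y  = f x y

-- In the first two examples s₁(a₂ ⊙₀ a₂) = {a₀, a₂} ⊈ {a₁, a₂} = s₁ a₂ ⊙₀ s₁ a₂, and dually for t₁.
branching : FiniteStructure 3
branching = oneObject λ { a₂ a₂ → a₁ ∷ a₂ ∷ [] ; _ _ → [] }

arrow : FiniteStructure 3
arrow = record { table = table ; src = src ; tgt = tgt }
  where
    table : Fin 3 → Fin 3 → List (Fin 3)
    table a₀ a₀ = a₀ ∷ []
    table a₀ a₁ = a₁ ∷ []
    table a₁ a₂ = a₁ ∷ []
    table a₂ a₂ = a₂ ∷ []
    table _  _  = []
    src tgt : Fin 3 → Fin 3
    src a₁ = a₀
    src x  = x
    tgt a₁ = a₂
    tgt x  = x

-- In the third, (a₂ ⊙₁ a₂) ⊙₀ (a₂ ⊙₁ a₂) = {a₀} while a₂ ⊙₀ a₂ = ∅.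
identitiesOnly : FiniteStructure 3
identitiesOnly = oneObject λ _ _ → []

involutive : FiniteStructure 3
involutive = oneObject λ { a₁ a₂ → a₁ ∷ [] ; a₂ a₁ → a₁ ∷ [] ; a₂ a₂ → a₀ ∷ [] ; _ _ → [] }

proposition6p13 : (α : ℕω) → TwoLe α →
    ((C : Set) (F : Family α C) →
      AllCatoids F → AxSrcHom F → AxTgtHom F → AxInterchange F →
      IsAlphaCatoid F)
    × Irredundant α
proposition6p13 α two =
    (λ C F → isAlphaCatoid F)
  , Irredundance.srcHom-independent two branching arrow _ _ _ _ _
  , Irredundance.tgtHom-independent two branching (Finite.opposite arrow) _ _ _ _ _
  , Irredundance.interchange-independent two identitiesOnly involutive _ _ _ _ _
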